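{- Let $m\ge1$, $n\ge 0$. The set of $1$-Dyck paths in $\mathcal D_{1,mn}$ in which the length of every ascent is a multiple of $m$ is an upper ideal of $\mathcal D_{1,mn}$ for the greedy $1$-Tamari order, and the greedy $m$-Tamari order on $\mathcal D_{m,n}$ is order-isomorphic to the greedy $1$-Tamari order restricted to this upper ideal.
   Context: An $m$-Dyck path of size $n$ is a word with $n$ letters $1$ (up steps $(+m,+m)$) and $mn$ letters $0$ (down steps $(+1,-1)$) whose lattice path from $(0,0)$ never goes strictly below the horizontal axis; $\mathcal D_{m,n}$ is the set of these paths. A valley is an occurrence of the factor $01$; a Dyck factor is a factor (consecutive letters) which is itself an $m$-Dyck path. The greedy $m$-Tamari order is generated by the cover relations $w\triangleleft w'$, one per valley of $w$, where $w'$ is obtained by swapping the down step of the valley with the longest Dyck factor immediately following it. An ascent is a maximal sequence of consecutive up steps; its length is its number of steps. -}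

module Defs where

open import Data.Nat using (ℕ; zero; suc; _+_; _*_; _≤_)
open import Data.Nat.Divisibility using (_∣_)
open import Data.List using (List; []; _∷_; _++_; take; length; replicate; [_])
open import Data.Product using (Σ; ∃; _×_; _,_; proj₁)
open import Relation.Binary.PropositionalEquality using (_≡_)
open import Relation.Binary.Construct.Closure.ReflexiveTransitive using (Star)

-- Letters: U is the letter 1 (up step (+m,+m)), D is the letter 0 (down step (+1,-1)).
data Step : Set where
  U D : Step

#U : List Step → ℕ
#U []      = 0
#U (U ∷ w) = suc (#U w)
#U (D ∷ w) = #U w

#D : List Step → ℕ
#D []      = 0
#D (U ∷ w) = #D w
#D (D ∷ w) = suc (#D w)

NeverBelow : ℕ → List Step → Set
NeverBelow m w = ∀ k → #D (take k w) ≤ m * #U (take k w)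

Dyck : ℕ → ℕ → List Step → Set
Dyck m n w = (#U w ≡ n) × (#D w ≡ m * n) × NeverBelow m w

IsDyck : ℕ → List Step → Set
IsDyck m w = ∃ λ n → Dyck m n w

Cover : ℕ → List Step → List Step → Set
Cover m w w' =
  Σ (List Step) λ u → Σ (List Step) λ v₀ → Σ (List Step) λ r →
    let v = U ∷ v₀ in
    (w ≡ u ++ D ∷ v ++ r) ×
    (w' ≡ u ++ v ++ D ∷ r) ×
    IsDyck m v ×
    (∀ v' r' → v ++ r ≡ v' ++ r' → IsDyck m v' → length v' ≤ length v)

_≤T[_]_ : List Step → ℕ → List Step → Set
w ≤T[ m ] w' = Star (Cover m) w w'

-- Every ascent (maximal run of consecutive up steps) has length divisible by m.
EndsWithU : List Step → Set
EndsWithU u = ∃ λ u' → u ≡ u' ++ [ U ]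

StartsWithU : List Step → Set
StartsWithU r = ∃ λ r' → r ≡ U ∷ r'

AscentsMultipleOf : ℕ → List Step → Set
AscentsMultipleOf m w =
  ∀ u k r → w ≡ u ++ replicate (suc k) U ++ r →
    (EndsWithU u → Data.Empty.⊥) → (StartsWithU r → Data.Empty.⊥) → m ∣ suc k
  where import Data.Empty

UpperIdeal : ℕ → ℕ → (List Step → Set) → Set
UpperIdeal m n P =
  ∀ w w' → Dyck m n w → P w → Dyck m n w' → w ≤T[ m ] w' → P w'

𝒟 : ℕ → ℕ → Set
𝒟 m n = Σ (List Step) (Dyck m n)

𝒜 : ℕ → ℕ → Set
𝒜 m n = Σ (List Step) λ w → Dyck 1 (m * n) w × AscentsMultipleOf m w

OrderIso : ℕ → ℕ → Set
OrderIso m n =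
  Σ (𝒟 m n → 𝒜 m n) λ f → Σ (𝒜 m n → 𝒟 m n) λ g →
    (∀ x → proj₁ (g (f x)) ≡ proj₁ x) ×
    (∀ y → proj₁ (f (g y)) ≡ proj₁ y) ×
    (∀ x y → proj₁ x ≤T[ m ] proj₁ y → proj₁ (f x) ≤T[ 1 ] proj₁ (f y)) ×
    (∀ x y → proj₁ (f x) ≤T[ 1 ] proj₁ (f y) → proj₁ x ≤T[ m ] proj₁ y)

{-# OPTIONS --safe #-}
module Submission where

-- Expanding every up step into m up steps maps 𝒟_{m,n} bijectively onto the 1-Dyck paths of
-- size mn whose ascents all have length divisible by m.  An expanded word can be cut only at
-- a down step or at its ends, and a nonempty 1-Dyck factor ends with a down step, so the Dyck
-- factors of an expanded word are exactly the expansions of Dyck factors, with their lengths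
-- in the same order.  Hence the covers of m-Tamari correspond to the covers of 1-Tamari out of
-- expanded paths, and every 1-cover out of an expanded path ends at an expanded path.

open import Defs
open import Data.Nat using (ℕ; zero; suc; _+_; _*_; _≤_; z≤n; s≤s)
open import Data.Nat.Properties
  using (+-suc; +-comm; +-identityʳ; *-comm; *-suc; *-identityˡ; *-monoʳ-≤; *-cancelˡ-≤; *-cancelˡ-≡; ≤-pred; n≮n; module ≤-Reasoning)
open import Data.Nat.Tactic.RingSolver using (solve-∀)
open import Data.Nat.Divisibility using (_∣_; divides; _∣0)
open import Data.List using (List; []; _∷_; _++_; _∷ʳ_; take; length; replicate; [_])
open import Data.List.Properties using (++-assoc; ++-identityʳ; ++-cancelˡ; ∷-injectiveʳ; ∷ʳ-injectiveʳ)
open import Data.List.Reverse using (reverseView; []; _∶_∶ʳ_)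
open import Data.Product using (∃; ∃₂; _×_; _,_; proj₁; proj₂)
open import Data.Sum using (_⊎_; inj₁; inj₂)
open import Data.Empty using (⊥; ⊥-elim)
open import Data.Unit using (⊤; tt)
open import Function using (id)
open import Function.Bundles using (_⇔_; mk⇔; Equivalence)
open import Relation.Nullary using (¬_)
open import Relation.Binary.PropositionalEquality hiding ([_])
open import Relation.Binary.Construct.Closure.ReflexiveTransitive using (Star; ε; _◅_; gmap)

open Equivalence using (to; from)

#U-++ : ∀ a b → #U (a ++ b) ≡ #U a + #U b
#U-++ []      b = refl
#U-++ (U ∷ a) b = cong suc (#U-++ a b)
#U-++ (D ∷ a) b = #U-++ a b

#D-++ : ∀ a b → #D (a ++ b) ≡ #D a + #D b
#D-++ []      b = refl
#D-++ (U ∷ a) b = #D-++ a b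
#D-++ (D ∷ a) b = cong suc (#D-++ a b)

length≡#U+#D : ∀ w → length w ≡ #U w + #D w
length≡#U+#D []      = refl
length≡#U+#D (U ∷ w) = cong suc (length≡#U+#D w)
length≡#U+#D (D ∷ w) = trans (cong suc (length≡#U+#D w)) (sym (+-suc (#U w) (#D w)))

#U-replicate : ∀ n → #U (replicate n U) ≡ n
#U-replicate zero    = refl
#U-replicate (suc n) = cong suc (#U-replicate n)

#D-replicate : ∀ n → #D (replicate n U) ≡ 0
#D-replicate zero    = refl
#D-replicate (suc n) = #D-replicate n

module _ {A : Set} where

  take-length-++ : ∀ (a b : List A) → take (length a) (a ++ b) ≡ a
  take-length-++ []      b = refl
  take-length-++ (c ∷ a) b = cong (c ∷_) (take-length-++ a b)

  replicate-++ : ∀ (c : A) i j → replicate i c ++ replicate j c ≡ replicate (i + j) c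
  replicate-++ c zero    j = refl
  replicate-++ c (suc i) j = cong (c ∷_) (replicate-++ c i j)

  replicate-++-∷ : ∀ (c : A) j w → replicate j c ++ c ∷ w ≡ c ∷ replicate j c ++ w
  replicate-++-∷ c zero    w = refl
  replicate-++-∷ c (suc j) w = cong (c ∷_) (replicate-++-∷ c j w)

replicateU-++≡-D∷ : ∀ k a p q → replicate k U ++ a ≡ p ++ D ∷ q →
  ∃ λ p' → (p ≡ replicate k U ++ p') × (a ≡ p' ++ D ∷ q)
replicateU-++≡-D∷ zero    a p       q eq = p , refl , eq
replicateU-++≡-D∷ (suc k) a []      q ()
replicateU-++≡-D∷ (suc k) a (D ∷ p) q ()
replicateU-++≡-D∷ (suc k) a (U ∷ p) q eq with replicateU-++≡-D∷ k a p q (∷-injectiveʳ eq)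
... | p' , refl , a≡ = p' , refl , a≡

¬endsWithU-[] : ¬ EndsWithU []
¬endsWithU-[] ([]    , ())
¬endsWithU-[] (_ ∷ _ , ())

endsWithU-++-D∷ : ∀ p u → EndsWithU (p ++ D ∷ u) → EndsWithU u
endsWithU-++-D∷ p u (u' , eq) with reverseView u
... | [] with () ← ∷ʳ-injectiveʳ p u' eq
... | s ∶ _ ∶ʳ c =
  s , cong (s ∷ʳ_) (∷ʳ-injectiveʳ (p ++ D ∷ s) u' (trans (++-assoc p (D ∷ s) [ c ]) eq))

NeverBelowFrom : ℕ → ℕ → List Step → Set
NeverBelowFrom m h       []      = ⊤
NeverBelowFrom m h       (U ∷ w) = NeverBelowFrom m (m + h) w
NeverBelowFrom m zero    (D ∷ w) = ⊥
NeverBelowFrom m (suc h) (D ∷ w) = NeverBelowFrom m h w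

height-after-U : ∀ m h t → h + m * suc t ≡ (m + h) + m * t
height-after-U = solve-∀

prefixBound⇒neverBelowFrom : ∀ m h w →
  (∀ k → #D (take k w) ≤ h + m * #U (take k w)) → NeverBelowFrom m h w
prefixBound⇒neverBelowFrom m h       []      bound = tt
prefixBound⇒neverBelowFrom m h       (U ∷ w) bound =
  prefixBound⇒neverBelowFrom m (m + h) w λ k →
    subst (#D (take k w) ≤_) (height-after-U m h (#U (take k w))) (bound (suc k))
prefixBound⇒neverBelowFrom m zero    (D ∷ w) bound with () ← subst (1 ≤_) (*-comm m 0) (bound 1)
prefixBound⇒neverBelowFrom m (suc h) (D ∷ w) bound =
  prefixBound⇒neverBelowFrom m h w λ k → ≤-pred (bound (suc k))

neverBelowFrom⇒prefixBound : ∀ m h w →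
  NeverBelowFrom m h w → ∀ k → #D (take k w) ≤ h + m * #U (take k w)
neverBelowFrom⇒prefixBound m h       w       nb zero    = z≤n
neverBelowFrom⇒prefixBound m h       []      nb (suc k) = z≤n
neverBelowFrom⇒prefixBound m h       (U ∷ w) nb (suc k) =
  subst (#D (take k w) ≤_) (sym (height-after-U m h (#U (take k w))))
    (neverBelowFrom⇒prefixBound m (m + h) w nb k)
neverBelowFrom⇒prefixBound m (suc h) (D ∷ w) nb (suc k) =
  s≤s (neverBelowFrom⇒prefixBound m h w nb k)

neverBelowFrom-replicate : ∀ j h y →
  NeverBelowFrom 1 h (replicate j U ++ y) ≡ NeverBelowFrom 1 (j + h) y
neverBelowFrom-replicate zero    h y = refl
neverBelowFrom-replicate (suc j) h y =
  trans (neverBelowFrom-replicate j (suc h) y) (cong (λ t → NeverBelowFrom 1 t y) (+-suc j h))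

length-dyck : ∀ m {n w} → Dyck m n w → length w ≡ suc m * n
length-dyck m {w = w} (#U≡ , #D≡ , _) = trans (length≡#U+#D w) (cong₂ _+_ #U≡ #D≡)

size-≤⇔length-≤ : ∀ m {a b p q} → Dyck m a p → Dyck m b q → (a ≤ b) ⇔ (length p ≤ length q)
size-≤⇔length-≤ m dp dq = mk⇔
  (λ a≤b → subst₂ _≤_ (sym (length-dyck m dp)) (sym (length-dyck m dq)) (*-monoʳ-≤ (suc m) a≤b))
  (λ p≤q → *-cancelˡ-≤ (suc m) (subst₂ _≤_ (length-dyck m dp) (length-dyck m dq) p≤q))

-- Before its last up step the path is at height ≥ 0, so it would end at height ≥ suc m.
¬dyck-∷ʳU : ∀ {m n} a → ¬ Dyck (suc m) n (a ∷ʳ U)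
¬dyck-∷ʳU {m} {n} a (#U≡ , #D≡ , nb) =
  n≮n (#U a) (*-cancelˡ-≤ {suc (#U a)} {#U a} (suc m) (begin
    suc m * suc (#U a)  ≡⟨ cong (suc m *_) #U-a ⟩
    suc m * n           ≡⟨ #D-a ⟨
    #D a                ≤⟨ subst (λ t → #D t ≤ suc m * #U t) (take-length-++ a [ U ]) (nb (length a)) ⟩
    suc m * #U a        ∎))
  where
  open ≤-Reasoning
  #U-a : suc (#U a) ≡ n
  #U-a = trans (+-comm 1 (#U a)) (trans (sym (#U-++ a [ U ])) #U≡)
  #D-a : #D a ≡ suc m * n
  #D-a = trans (sym (trans (#D-++ a [ U ]) (+-identityʳ (#D a)))) #D≡

isDyck-view : ∀ m {v} → IsDyck (suc m) v → v ≡ [] ⊎ ∃ λ v' → v ≡ v' ∷ʳ D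
isDyck-view m {v} (_ , dv) with reverseView v
... | []          = inj₁ refl
... | v' ∶ _ ∶ʳ D = inj₂ (v' , refl)
... | v' ∶ _ ∶ʳ U = ⊥-elim (¬dyck-∷ʳU {m} v' dv)

expand : ℕ → List Step → List Step
expand m []      = []
expand m (U ∷ x) = replicate m U ++ expand m x
expand m (D ∷ x) = D ∷ expand m x

expand-++ : ∀ m a b → expand m (a ++ b) ≡ expand m a ++ expand m b
expand-++ m []      b = refl
expand-++ m (U ∷ a) b =
  trans (cong (replicate m U ++_) (expand-++ m a b)) (sym (++-assoc (replicate m U) (expand m a) _))
expand-++ m (D ∷ a) b = cong (D ∷_) (expand-++ m a b)

expand-replicate : ∀ m q → expand m (replicate q U) ≡ replicate (q * m) U
expand-replicate m zero    = refl
expand-replicate m (suc q) =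
  trans (cong (replicate m U ++_) (expand-replicate m q)) (replicate-++ U m (q * m))

#U-expand : ∀ m x → #U (expand m x) ≡ m * #U x
#U-expand m []      = *-comm 0 m
#U-expand m (U ∷ x) = begin
  #U (replicate m U ++ expand m x)     ≡⟨ #U-++ (replicate m U) (expand m x) ⟩
  #U (replicate m U) + #U (expand m x) ≡⟨ cong₂ _+_ (#U-replicate m) (#U-expand m x) ⟩
  m + m * #U x                         ≡⟨ *-suc m (#U x) ⟨
  m * suc (#U x)                       ∎
  where open ≡-Reasoning
#U-expand m (D ∷ x) = #U-expand m x

#D-expand : ∀ m x → #D (expand m x) ≡ #D x
#D-expand m []      = refl
#D-expand m (U ∷ x) =
  trans (#D-++ (replicate m U) (expand m x)) (cong₂ _+_ (#D-replicate m) (#D-expand m x))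
#D-expand m (D ∷ x) = cong suc (#D-expand m x)

neverBelowFrom-expand : ∀ m h x → NeverBelowFrom 1 h (expand m x) ≡ NeverBelowFrom m h x
neverBelowFrom-expand m h       []      = refl
neverBelowFrom-expand m h       (U ∷ x) =
  trans (neverBelowFrom-replicate m h (expand m x)) (neverBelowFrom-expand m (m + h) x)
neverBelowFrom-expand m zero    (D ∷ x) = refl
neverBelowFrom-expand m (suc h) (D ∷ x) = neverBelowFrom-expand m h x

neverBelow-expand : ∀ m x → NeverBelow 1 (expand m x) ⇔ NeverBelow m x
neverBelow-expand m x = mk⇔
  (λ nb → neverBelowFrom⇒prefixBound m 0 x
            (subst id (neverBelowFrom-expand m 0 x) (prefixBound⇒neverBelowFrom 1 0 (expand m x) nb)))
  (λ nb → neverBelowFrom⇒prefixBound 1 0 (expand m x)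
            (subst id (sym (neverBelowFrom-expand m 0 x)) (prefixBound⇒neverBelowFrom m 0 x nb)))

expand≡U∷ : ∀ m x v → expand m x ≡ U ∷ v → ∃ λ x' → x ≡ U ∷ x'
expand≡U∷ m (U ∷ x') v eq = x' , refl

expand≡++-D∷ : ∀ m x p q → expand m x ≡ p ++ D ∷ q →
  ∃₂ λ x₁ x₂ → (x ≡ x₁ ++ D ∷ x₂) × (p ≡ expand m x₁) × (q ≡ expand m x₂)
expand≡++-D∷ m []      []      q ()
expand≡++-D∷ m []      (_ ∷ _) q ()
expand≡++-D∷ m (D ∷ x) []      q eq = [] , x , refl , refl , sym (∷-injectiveʳ eq)
expand≡++-D∷ m (D ∷ x) (U ∷ p) q ()
expand≡++-D∷ m (D ∷ x) (D ∷ p) q eq with expand≡++-D∷ m x p q (∷-injectiveʳ eq)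
... | x₁ , x₂ , refl , refl , q≡ = D ∷ x₁ , x₂ , refl , refl , q≡
expand≡++-D∷ m (U ∷ x) p       q eq with replicateU-++≡-D∷ m (expand m x) p q eq
... | p' , refl , x≡ with expand≡++-D∷ m x p' q x≡
... | x₁ , x₂ , refl , refl , q≡ = U ∷ x₁ , x₂ , refl , refl , q≡

expand≡++-dyck : ∀ m x v r → expand m x ≡ v ++ r → IsDyck 1 v →
  ∃₂ λ x₁ x₂ → (x ≡ x₁ ++ x₂) × (expand m x₁ ≡ v) × (expand m x₂ ≡ r)
expand≡++-dyck m x v r eq dv with isDyck-view 0 dv
... | inj₁ refl = [] , x , refl , refl , eq
... | inj₂ (v' , refl) with expand≡++-D∷ m x v' r (trans eq (++-assoc v' [ D ] r))
... | x₁ , x₂ , refl , refl , refl =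
  x₁ ∷ʳ D , x₂ , sym (++-assoc x₁ [ D ] x₂) , expand-++ m x₁ [ D ] , refl

dyck-expand⁺ : ∀ m {n x} → Dyck m n x → Dyck 1 (m * n) (expand m x)
dyck-expand⁺ m {n} {x} (#U≡ , #D≡ , nb) =
  trans (#U-expand m x) (cong (m *_) #U≡) ,
  trans (#D-expand m x) (trans #D≡ (sym (*-identityˡ (m * n)))) ,
  from (neverBelow-expand m x) nb

isDyck-expand⁺ : ∀ m {v} → IsDyck m v → IsDyck 1 (expand m v)
isDyck-expand⁺ m (n , dv) = m * n , dyck-expand⁺ m dv

expand≡replicate⇒∣ : ∀ m y n → expand m y ≡ replicate n U → m ∣ n
expand≡replicate⇒∣ m y n eq = divides (#U y) (begin
  n                  ≡⟨ #U-replicate n ⟨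
  #U (replicate n U) ≡⟨ cong #U eq ⟨
  #U (expand m y)    ≡⟨ #U-expand m y ⟩
  m * #U y           ≡⟨ *-comm m (#U y) ⟩
  #U y * m           ∎)
  where open ≡-Reasoning

expand≡replicate-++⇒∣ : ∀ m y n r → expand m y ≡ replicate n U ++ r → ¬ StartsWithU r → m ∣ n
expand≡replicate-++⇒∣ m y n []       eq _  = expand≡replicate⇒∣ m y n (trans eq (++-identityʳ _))
expand≡replicate-++⇒∣ m y n (U ∷ r') eq ¬U = ⊥-elim (¬U (r' , refl))
expand≡replicate-++⇒∣ m y n (D ∷ r') eq _ with expand≡++-D∷ m y (replicate n U) r' eq
... | y₁ , _ , _ , e , _ = expand≡replicate⇒∣ m y₁ n (sym e)

ascentsMultipleOf-expand : ∀ m x → AscentsMultipleOf m (expand m x)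
ascentsMultipleOf-expand m x u k r eq ¬endU ¬startU with reverseView u
... | []          = expand≡replicate-++⇒∣ m x (suc k) r eq ¬startU
... | s ∶ _ ∶ʳ U = ⊥-elim (¬endU (s , refl))
... | s ∶ _ ∶ʳ D with expand≡++-D∷ m x s _ (trans eq (++-assoc s [ D ] _))
... | _ , x₂ , _ , _ , e = expand≡replicate-++⇒∣ m x₂ (suc k) r (sym e) ¬startU

ascentsMultipleOf-leading : ∀ m j w →
  AscentsMultipleOf m (replicate j U ++ w) → ¬ StartsWithU w → m ∣ j
ascentsMultipleOf-leading m zero    w am ¬startU = m ∣0
ascentsMultipleOf-leading m (suc k) w am ¬startU = am [] k w refl ¬endsWithU-[] ¬startU

ascentsMultipleOf-++-D∷ : ∀ m p w → AscentsMultipleOf m (p ++ D ∷ w) → AscentsMultipleOf m w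
ascentsMultipleOf-++-D∷ m p w am u k r eq ¬endU ¬startU =
  am (p ++ D ∷ u) k r
    (trans (cong (λ t → p ++ D ∷ t) eq) (sym (++-assoc p (D ∷ u) _)))
    (λ endU → ¬endU (endsWithU-++-D∷ p u endU)) ¬startU

ascentsMultipleOf⇒expand : ∀ m w → AscentsMultipleOf m w → ∃ λ x → w ≡ expand m x
ascentsMultipleOf⇒expand m = afterAscent 0
  where
  afterAscent : ∀ j w → AscentsMultipleOf m (replicate j U ++ w) →
    ∃ λ x → replicate j U ++ w ≡ expand m x
  afterAscent j [] am with ascentsMultipleOf-leading m j [] am (λ ())
  ... | divides q refl = replicate q U , trans (++-identityʳ _) (sym (expand-replicate m q))
  afterAscent j (U ∷ w) am
    with afterAscent (suc j) w (subst (AscentsMultipleOf m) (replicate-++-∷ U j w) am)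
  ... | x , e = x , trans (replicate-++-∷ U j w) e
  afterAscent j (D ∷ w) am
    with ascentsMultipleOf-leading m j (D ∷ w) am (λ ())
       | afterAscent 0 w (ascentsMultipleOf-++-D∷ m (replicate j U) w am)
  ... | divides q refl | x , refl =
    replicate q U ++ D ∷ x ,
    sym (trans (expand-++ m (replicate q U) (D ∷ x)) (cong (_++ D ∷ expand m x) (expand-replicate m q)))

-- The maximality clause of Cover m is LongestDyckPrefix m (U ∷ v₀) ((U ∷ v₀) ++ r).
LongestDyckPrefix : ℕ → List Step → List Step → Set
LongestDyckPrefix m v w = ∀ v' r' → w ≡ v' ++ r' → IsDyck m v' → length v' ≤ length v

module _ (m-1 : ℕ) where

  private
    m : ℕ
    m = suc m-1

  expand-injective : ∀ {a b} → expand m a ≡ expand m b → a ≡ b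
  expand-injective {[]}    {[]}    eq = refl
  expand-injective {U ∷ a} {U ∷ b} eq =
    cong (U ∷_) (expand-injective (++-cancelˡ (replicate m U) _ _ eq))
  expand-injective {D ∷ a} {D ∷ b} eq = cong (D ∷_) (expand-injective (∷-injectiveʳ eq))
  expand-injective {[]}    {U ∷ b} ()
  expand-injective {[]}    {D ∷ b} ()
  expand-injective {U ∷ a} {[]}    ()
  expand-injective {U ∷ a} {D ∷ b} ()
  expand-injective {D ∷ a} {[]}    ()
  expand-injective {D ∷ a} {U ∷ b} ()

  dyck-expand⁻ : ∀ {n x} → Dyck 1 (m * n) (expand m x) → Dyck m n x
  dyck-expand⁻ {n} {x} (#U≡ , #D≡ , nb) =
    *-cancelˡ-≡ (#U x) n m (trans (sym (#U-expand m x)) #U≡) ,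
    trans (sym (#D-expand m x)) (trans #D≡ (*-identityˡ (m * n))) ,
    to (neverBelow-expand m x) nb

  isDyck-expand⁻ : ∀ {v} → IsDyck 1 (expand m v) → IsDyck m v
  isDyck-expand⁻ {v} (k , dv@(#U≡ , _)) =
    #U v , dyck-expand⁻ (subst (λ k → Dyck 1 k (expand m v)) k≡ dv)
    where
    k≡ : k ≡ m * #U v
    k≡ = trans (sym #U≡) (#U-expand m v)

  length-≤-expand : ∀ {p q} → IsDyck m p → IsDyck m q →
    (length p ≤ length q) ⇔ (length (expand m p) ≤ length (expand m q))
  length-≤-expand (a , dp) (b , dq) = mk⇔
    (λ p≤q → to sizes₁ (*-monoʳ-≤ m (from sizes p≤q)))
    (λ Ep≤Eq → to sizes (*-cancelˡ-≤ m (from sizes₁ Ep≤Eq)))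
    where
    sizes  = size-≤⇔length-≤ m dp dq
    sizes₁ = size-≤⇔length-≤ 1 (dyck-expand⁺ m dp) (dyck-expand⁺ m dq)

  longestDyckPrefix-expand⁺ : ∀ {v r} → IsDyck m v →
    LongestDyckPrefix m v (v ++ r) →
    LongestDyckPrefix 1 (expand m v) (expand m v ++ expand m r)
  longestDyckPrefix-expand⁺ {v} {r} dv longest v' r' eq dv'
    with expand≡++-dyck m (v ++ r) v' r' (trans (expand-++ m v r) eq) dv'
  ... | x₁ , x₂ , v++r≡ , refl , _ = to (length-≤-expand dx₁ dv) (longest x₁ x₂ v++r≡ dx₁)
    where dx₁ = isDyck-expand⁻ dv'

  longestDyckPrefix-expand⁻ : ∀ {v r} → IsDyck m v →
    LongestDyckPrefix 1 (expand m v) (expand m v ++ expand m r) →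
    LongestDyckPrefix m v (v ++ r)
  longestDyckPrefix-expand⁻ {v} {r} dv longest v' r' eq dv' =
    from (length-≤-expand dv' dv) (longest (expand m v') (expand m r') Eeq (isDyck-expand⁺ m dv'))
    where
    Eeq : expand m v ++ expand m r ≡ expand m v' ++ expand m r'
    Eeq = trans (sym (expand-++ m v r)) (trans (cong (expand m) eq) (expand-++ m v' r'))

  cover-expand⁺ : ∀ {x y} → Cover m x y → Cover 1 (expand m x) (expand m y)
  cover-expand⁺ (u , v₀ , r , refl , refl , dv , longest) =
    E u , replicate m-1 U ++ E v₀ , E r ,
    trans (expand-++ m u _) (cong (λ t → E u ++ D ∷ t) (expand-++ m (U ∷ v₀) r)) ,
    trans (expand-++ m u _) (cong (E u ++_) (expand-++ m (U ∷ v₀) (D ∷ r))) ,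
    isDyck-expand⁺ m dv ,
    longestDyckPrefix-expand⁺ dv longest
    where E = expand m

  cover-expand⁻ : ∀ {x z} → Cover 1 (expand m x) z →
    ∃ λ y → z ≡ expand m y × Cover m x y
  -- Cut x at the down step of the valley, then after the Dyck factor, which starts with U.
  cover-expand⁻ {x} (u , v₀ , r , ex , refl , dv , longest)
    with expand≡++-D∷ m x u _ ex
  ... | x₁ , x₂ , refl , refl , e₂ with expand≡++-dyck m x₂ (U ∷ v₀) r (sym e₂) dv
  ... | a , b , refl , ea , refl with expand≡U∷ m a v₀ ea
  ... | a₀ , refl with ea
  ... | refl =
    x₁ ++ U ∷ a₀ ++ D ∷ b ,
    sym (trans (expand-++ m x₁ _) (cong (E x₁ ++_) (expand-++ m (U ∷ a₀) (D ∷ b)))) ,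
    (x₁ , a₀ , b , refl , refl , dv₁ , longestDyckPrefix-expand⁻ dv₁ longest)
    where
    E = expand m
    dv₁ = isDyck-expand⁻ dv

  star-cover-expand⁻ : ∀ {x z} → Star (Cover 1) (expand m x) z →
    ∃ λ y → z ≡ expand m y × Star (Cover m) x y
  star-cover-expand⁻ {x} ε = x , refl , ε
  star-cover-expand⁻ (c ◅ s) with cover-expand⁻ c
  ... | y , refl , c' with star-cover-expand⁻ s
  ... | z , z≡ , s' = z , z≡ , c' ◅ s'

  ascentsMultipleOf-upwardClosed : ∀ {w z} → Star (Cover 1) w z →
    AscentsMultipleOf m w → AscentsMultipleOf m z
  ascentsMultipleOf-upwardClosed {w} w≤z am with ascentsMultipleOf⇒expand m w am
  ... | x , refl with star-cover-expand⁻ {x} w≤z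
  ... | y , refl , _ = ascentsMultipleOf-expand m y

  expand-orderIso : ∀ n → OrderIso m n
  expand-orderIso n = f , g , g∘f , f∘g , (λ _ _ → gmap (expand m) cover-expand⁺) , (λ _ _ → reflect)
    where
    f : 𝒟 m n → 𝒜 m n
    f (x , dx) = expand m x , dyck-expand⁺ m dx , ascentsMultipleOf-expand m x

    preimage : (w : List Step) → AscentsMultipleOf m w → ∃ λ x → w ≡ expand m x
    preimage = ascentsMultipleOf⇒expand m

    g : 𝒜 m n → 𝒟 m n
    g (w , dw , am) =
      let x , w≡ = preimage w am
      in x , dyck-expand⁻ (subst (Dyck 1 (m * n)) w≡ dw)

    g∘f : ∀ x → proj₁ (g (f x)) ≡ proj₁ x
    g∘f (x , _) = expand-injective (sym (proj₂ (preimage (expand m x) _)))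

    f∘g : ∀ y → proj₁ (f (g y)) ≡ proj₁ y
    f∘g (w , _ , am) = sym (proj₂ (preimage w am))

    reflect : ∀ {x y} → Star (Cover 1) (expand m x) (expand m y) → Star (Cover m) x y
    reflect {x} Ex≤Ey with star-cover-expand⁻ {x} Ex≤Ey
    ... | y' , Ey≡ , x≤y' = subst (Star (Cover m) x) (expand-injective (sym Ey≡)) x≤y'

proposition2p1 : (m n : ℕ) → 1 ≤ m →
    UpperIdeal 1 (m * n) (AscentsMultipleOf m) × OrderIso m n
proposition2p1 (suc m-1) n _ =
  (λ _ _ _ am _ w≤w' → ascentsMultipleOf-upwardClosed m-1 w≤w' am) , expand-orderIso m-1 n
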